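{- Let $v\geq0$ be an integer. Let $t^{(v)}(m,j)$ and $T^{(v)}(n,j)$ be the Stirling type numbers of the first and second kind associated with the sequence $a_n=n(n+v)$, define polynomials $F_n^{(v)}(z)$ for $n\geq1$ by \[ zF_n^{(v)}(z)=\sum_{j=0}^n(-1)^{n+j}T^{(v)}(n,j)\,j!\,(z)^j, \] and set $g_n^{(v)}:=F_n^{(v)}(v)$ for $n\geq1$. Then for all integers $m\geq0$ and $n\geq1$, \[ \sum_{j=0}^m(-1)^{m+j}t^{(v)}(m,j)\,g_{n+j}^{(v)}=F_n^{(v)}(m+v)\,\frac{m!\,(m+v)!}{v!}. \]
   Context: $(z)^0=1$ and $(z)^n=z(z+1)\cdots(z+n-1)$ for $n\geq1$. Stirling type numbers for a sequence $(a_n)_{n\geq1}$: $t(n+1,j)=t(n,j-1)-a_nt(n,j)$ and $T(n+1,j)=T(n,j-1)+a_jT(n,j)$, with $t(n,0)=T(n,0)=\delta_{n,0}$ and $t(n,j)=T(n,j)=0$ for $n<j$. -}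

module Defs where

open import Data.Nat as ℕ using (ℕ; zero; suc)
open import Data.Nat.Properties using (_!≢0)
open import Data.Integer using (ℤ; +_; _+_; _*_; -_; _-_)

sgn : ℕ → ℤ
sgn zero    = + 1
sgn (suc k) = - sgn k

sumTo : ℕ → (ℕ → ℤ) → ℤ
sumTo zero    f = f 0
sumTo (suc n) f = sumTo n f + f (suc n)

rising : ℤ → ℕ → ℤ
rising z zero    = + 1
rising z (suc n) = rising z n * (z + + n)

fact : ℕ → ℤ
fact n = + (n ℕ.!)

stirling1 : (ℕ → ℤ) → ℕ → ℕ → ℤ
stirling1 a zero    zero    = + 1
stirling1 a zero    (suc j) = + 0
stirling1 a (suc n) zero    = + 0
stirling1 a (suc n) (suc j) = stirling1 a n j - a n * stirling1 a n (suc j)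

stirling2 : (ℕ → ℤ) → ℕ → ℕ → ℤ
stirling2 a zero    zero    = + 1
stirling2 a zero    (suc j) = + 0
stirling2 a (suc n) zero    = + 0
stirling2 a (suc n) (suc j) = stirling2 a n j + a (suc j) * stirling2 a n (suc j)

seqA : ℕ → ℕ → ℤ
seqA v n = + (n ℕ.* (n ℕ.+ v))

tv : ℕ → ℕ → ℕ → ℤ
tv v = stirling1 (seqA v)

Tv : ℕ → ℕ → ℕ → ℤ
Tv v = stirling2 (seqA v)

-- F_n^{(v)}(z), defined for n ≥ 1 by
--   z F_n(z) = Σ_{j=0}^n (-1)^{n+j} T(n,j) j! (z)^j .
-- Since T(n,0) = 0 for n ≥ 1 and (z)^j = z (z+1)^{j-1} for j ≥ 1, the
-- polynomial F_n is obtained by dividing out the factor z term by term: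
--   F_n(z) = Σ_{j=1}^n (-1)^{n+j} T(n,j) j! (z+1)^{j-1}.
-- (The j = 0 term contributes 0 here as well.)
Fv : ℕ → ℕ → ℤ → ℤ
Fv v n z = sumTo n term
  where
  term : ℕ → ℤ
  term zero    = + 0
  term (suc k) = sgn (n ℕ.+ suc k) * Tv v n (suc k) * fact (suc k) * rising (z + + 1) k

gv : ℕ → ℕ → ℤ
gv v n = Fv v n (+ v)

-- (m+v)! / v!  (exact division of naturals)
factRatio : ℕ → ℕ → ℕ
factRatio m v = ℕ._/_ ((m ℕ.+ v) ℕ.!) (v ℕ.!) ⦃ v !≢0 ⦄

-- Both kinds of Stirling-type numbers turn the recurrences into three-term
-- relations. For the second kind, the basis u_j(z) = j! (z)^j / z satisfies
-- (z+1)(z+1-v) u_j(z+1) - z(z-v) u_j(z) = u_{j+1}(z) - a_j u_j(z) for j ≥ 1,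
-- so F_{n+1}(z) = (z+1)(z+1-v) F_n(z+1) - z(z-v) F_n(z). For the first kind,
-- the sum S(m,n) on the left satisfies S(m+1,n) = S(m,n+1) + a_m S(m,n).
-- Induction on m then reduces the claim to these two relations at z = m+v,
-- where z - v = m and a_m = m z make the right-hand sides agree.
module Submission where

open import Defs
open import Data.Nat as ℕ using (ℕ; suc; zero; s≤s; z≤n; _!)
open import Data.Nat.Properties using (_!≢0; m≤n+m; n<1+n; m≤n⇒m≤1+n; +-suc)
import Data.Nat.Properties as ℕP
open import Data.Nat.Divisibility using (m≤n⇒m!∣n!)
open import Data.Nat.DivMod using (*-/-assoc; n/n≡1)
open import Data.Integer using (ℤ; +_; _*_; _+_; _-_; -_)
open import Data.Integer.Properties using (+-identityˡ; +-identityʳ; +-assoc; *-zeroʳ; *-distribˡ-+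
  ; pos-+; pos-*; neg-distribˡ-*; *-assoc; m-n≡m⊖n; ⊖-≥; *-identityˡ; *-identityʳ)
open import Data.Integer.Tactic.RingSolver using (solve-∀)
open import Relation.Binary.PropositionalEquality
  using (_≡_; refl; sym; trans; cong; cong₂; module ≡-Reasoning)

sumTo-cong : ∀ n {f g : ℕ → ℤ} → (∀ j → f j ≡ g j) → sumTo n f ≡ sumTo n g
sumTo-cong zero    f≡g = f≡g 0
sumTo-cong (suc n) f≡g = cong₂ _+_ (sumTo-cong n f≡g) (f≡g (suc n))

sumTo-+ : ∀ n (f g : ℕ → ℤ) → sumTo n (λ j → f j + g j) ≡ sumTo n f + sumTo n g
sumTo-+ zero    f g = refl
sumTo-+ (suc n) f g =
  trans (cong (_+ (f (suc n) + g (suc n))) (sumTo-+ n f g))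
        (swap-middle (sumTo n f) (sumTo n g) (f (suc n)) (g (suc n)))
  where
  swap-middle : ∀ (a b c d : ℤ) → (a + b) + (c + d) ≡ (a + c) + (b + d)
  swap-middle = solve-∀

sumTo-*ˡ : ∀ n (c : ℤ) (f : ℕ → ℤ) → sumTo n (λ j → c * f j) ≡ c * sumTo n f
sumTo-*ˡ zero    c f = refl
sumTo-*ˡ (suc n) c f =
  trans (cong (_+ c * f (suc n)) (sumTo-*ˡ n c f)) (sym (*-distribˡ-+ c (sumTo n f) (f (suc n))))

sumTo-suc : ∀ n (f : ℕ → ℤ) → sumTo (suc n) f ≡ f 0 + sumTo n (λ j → f (suc j))
sumTo-suc zero    f = refl
sumTo-suc (suc n) f =
  trans (cong (_+ f (suc (suc n))) (sumTo-suc n f))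
        (+-assoc (f 0) (sumTo n (λ j → f (suc j))) (f (suc (suc n))))

sumTo-suc-vanishing : ∀ n (g : ℕ → ℤ) → g 0 ≡ + 0 → g (suc n) ≡ + 0 →
  sumTo n (λ j → g (suc j)) ≡ sumTo n g
sumTo-suc-vanishing n g g0≡0 gn≡0 = begin
  sumTo n (λ j → g (suc j))         ≡⟨ +-identityˡ _ ⟨
  + 0 + sumTo n (λ j → g (suc j))   ≡⟨ cong (_+ sumTo n (λ j → g (suc j))) g0≡0 ⟨
  g 0 + sumTo n (λ j → g (suc j))   ≡⟨ sumTo-suc n g ⟨
  sumTo n g + g (suc n)             ≡⟨ cong (_+_ (sumTo n g)) gn≡0 ⟩
  sumTo n g + + 0                   ≡⟨ +-identityʳ _ ⟩
  sumTo n g                         ∎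
  where open ≡-Reasoning

sumTo-pascal : ∀ n {h f g : ℕ → ℤ} → h 0 ≡ + 0 → g 0 ≡ + 0 → g (suc n) ≡ + 0 →
  (∀ k → h (suc k) ≡ f k + g (suc k)) → sumTo (suc n) h ≡ sumTo n f + sumTo n g
sumTo-pascal n {h} {f} {g} h0≡0 g0≡0 gn≡0 h-rec = begin
  sumTo (suc n) h                        ≡⟨ sumTo-suc n h ⟩
  h 0 + sumTo n (λ k → h (suc k))        ≡⟨ cong₂ _+_ h0≡0 (sumTo-cong n h-rec) ⟩
  + 0 + sumTo n (λ k → f k + g (suc k))  ≡⟨ +-identityˡ _ ⟩
  sumTo n (λ k → f k + g (suc k))        ≡⟨ sumTo-+ n f (λ k → g (suc k)) ⟩
  sumTo n f + sumTo n (λ k → g (suc k))  ≡⟨ cong (_+_ (sumTo n f)) (sumTo-suc-vanishing n g g0≡0 gn≡0) ⟩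
  sumTo n f + sumTo n g                  ∎
  where open ≡-Reasoning

sgn-+-suc : ∀ m k → sgn (m ℕ.+ suc k) ≡ - sgn (m ℕ.+ k)
sgn-+-suc m k = cong sgn (+-suc m k)

x*0*y≡0 : ∀ x y → x * + 0 * y ≡ + 0
x*0*y≡0 = solve-∀

stirling1-vanishing : ∀ a {n j} → n ℕ.< j → stirling1 a n j ≡ + 0
stirling1-vanishing a {zero}  {suc j} _       = refl
stirling1-vanishing a {suc n} {suc j} (s≤s n<j)
  rewrite stirling1-vanishing a n<j | stirling1-vanishing a (m≤n⇒m≤1+n n<j) | *-zeroʳ (a n)
  = refl

stirling2-vanishing : ∀ a {n j} → n ℕ.< j → stirling2 a n j ≡ + 0
stirling2-vanishing a {zero}  {suc j} _       = refl
stirling2-vanishing a {suc n} {suc j} (s≤s n<j)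
  rewrite stirling2-vanishing a n<j | stirling2-vanishing a (m≤n⇒m≤1+n n<j) | *-zeroʳ (a (suc j))
  = refl

stirling1Sum : (ℕ → ℤ) → ℕ → (ℕ → ℤ) → ℤ
stirling1Sum a m G = sumTo m (λ j → sgn (m ℕ.+ j) * stirling1 a m j * G j)

stirling2Sum : (ℕ → ℤ) → ℕ → (ℕ → ℤ) → ℤ
stirling2Sum a n U = sumTo n (λ j → sgn (n ℕ.+ j) * stirling2 a n j * U j)

-- Defs puts t(1,0) = 0, which matches t(1,0) = -a_0 t(0,0) only when a 0 = 0.
stirling1Sum-suc : ∀ a → a 0 ≡ + 0 → ∀ m G →
  stirling1Sum a (suc m) G ≡ stirling1Sum a m (λ j → G (suc j)) + a m * stirling1Sum a m G
stirling1Sum-suc a a0≡0 m G =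
  trans (sumTo-pascal m {term′} (x*0*y≡0 (sgn (suc m ℕ.+ 0)) (G 0)) g0≡0 gm≡0 pascal)
        (cong (_+_ (stirling1Sum a m (λ j → G (suc j)))) (sumTo-*ˡ m (a m) term))
  where
  term : ℕ → ℤ
  term j = sgn (m ℕ.+ j) * stirling1 a m j * G j
  term′ : ℕ → ℤ
  term′ j = sgn (suc m ℕ.+ j) * stirling1 a (suc m) j * G j
  a*t≡0 : ∀ m → a m * stirling1 a m 0 ≡ + 0
  a*t≡0 zero    = cong (_* + 1) a0≡0
  a*t≡0 (suc m) = *-zeroʳ (a (suc m))
  g0≡0 : a m * term 0 ≡ + 0
  g0≡0 = begin
    a m * (σ₀ * stirling1 a m 0 * G 0)  ≡⟨ reassoc (a m) σ₀ (stirling1 a m 0) (G 0) ⟩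
    σ₀ * (a m * stirling1 a m 0) * G 0  ≡⟨ cong (λ x → σ₀ * x * G 0) (a*t≡0 m) ⟩
    σ₀ * + 0 * G 0                      ≡⟨ x*0*y≡0 σ₀ (G 0) ⟩
    + 0                                 ∎
    where
    open ≡-Reasoning
    σ₀ = sgn (m ℕ.+ 0)
    reassoc : ∀ (c σ t x : ℤ) → c * (σ * t * x) ≡ σ * (c * t) * x
    reassoc = solve-∀
  gm≡0 : a m * term (suc m) ≡ + 0
  gm≡0 rewrite stirling1-vanishing a (n<1+n m) | x*0*y≡0 (sgn (m ℕ.+ suc m)) (G (suc m))
    = *-zeroʳ (a m)
  pascal : ∀ k →
    term′ (suc k) ≡ sgn (m ℕ.+ k) * stirling1 a m k * G (suc k) + a m * term (suc k)
  pascal k rewrite sgn-+-suc m k =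
    identity (sgn (m ℕ.+ k)) (stirling1 a m k) (stirling1 a m (suc k)) (a m) (G (suc k))
    where
    identity : ∀ (σ x y c g : ℤ) → - - σ * (x - c * y) * g ≡ σ * x * g + c * (- σ * y * g)
    identity = solve-∀

stirling2Sum-suc : ∀ a {n} → 1 ℕ.≤ n → ∀ (α β : ℤ) (U U′ : ℕ → ℤ) →
  (∀ k → U (suc (suc k)) - a (suc k) * U (suc k) ≡ α * U′ (suc k) - β * U (suc k)) →
  stirling2Sum a (suc n) U ≡ α * stirling2Sum a n U′ - β * stirling2Sum a n U
stirling2Sum-suc a {n@(suc _)} _ α β U U′ U-rec = begin
  stirling2Sum a (suc n) U
    ≡⟨ sumTo-pascal n {term′} {f} {g} (x*0*y≡0 (sgn (suc n ℕ.+ 0)) (U 0)) g0≡0 gn≡0 pascal ⟩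
  sumTo n f + sumTo n g
    ≡⟨ sumTo-+ n f g ⟨
  sumTo n (λ k → f k + g k)
    ≡⟨ sumTo-cong n combine ⟩
  sumTo n (λ k → α * p U′ k + - β * p U k)
    ≡⟨ sumTo-+ n (λ k → α * p U′ k) (λ k → - β * p U k) ⟩
  sumTo n (λ k → α * p U′ k) + sumTo n (λ k → - β * p U k)
    ≡⟨ cong₂ _+_ (sumTo-*ˡ n α (p U′)) (sumTo-*ˡ n (- β) (p U)) ⟩
  α * sumTo n (p U′) + - β * sumTo n (p U)
    ≡⟨ cong (_+_ (α * sumTo n (p U′))) (neg-distribˡ-* β (sumTo n (p U))) ⟨
  α * stirling2Sum a n U′ - β * stirling2Sum a n U ∎
  where
  open ≡-Reasoning
  p : (ℕ → ℤ) → ℕ → ℤ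
  p W j = sgn (n ℕ.+ j) * stirling2 a n j * W j
  term′ f g : ℕ → ℤ
  term′ j = sgn (suc n ℕ.+ j) * stirling2 a (suc n) j * U j
  f k = p (λ j → U (suc j)) k
  g j = - (sgn (n ℕ.+ j) * stirling2 a n j * (a j * U j))
  g0≡0 : g 0 ≡ + 0
  g0≡0 = cong -_ (x*0*y≡0 (sgn (n ℕ.+ 0)) (a 0 * U 0))
  gn≡0 : g (suc n) ≡ + 0
  gn≡0 rewrite stirling2-vanishing a (n<1+n n) =
    cong -_ (x*0*y≡0 (sgn (n ℕ.+ suc n)) (a (suc n) * U (suc n)))
  pascal : ∀ k → term′ (suc k) ≡ f k + g (suc k)
  pascal k rewrite sgn-+-suc n k =
    identity (sgn (n ℕ.+ k)) (stirling2 a n k) (stirling2 a n (suc k)) (a (suc k)) (U (suc k))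
    where
    identity : ∀ (σ x y c u : ℤ) → - - σ * (x + c * y) * u ≡ σ * x * u + - (- σ * y * (c * u))
    identity = solve-∀
  combine : ∀ k → f k + g k ≡ α * p U′ k + - β * p U k
  combine zero    = vanish (sgn (n ℕ.+ 0)) (U 1) (a 0 * U 0) (U′ 0) (U 0) α β
    where
    vanish : ∀ (σ u₊ cu w′ w α β : ℤ) →
      σ * + 0 * u₊ + - (σ * + 0 * cu) ≡ α * (σ * + 0 * w′) + - β * (σ * + 0 * w)
    vanish = solve-∀
  combine (suc k) = begin
    σt * U (suc (suc k)) + - (σt * (a (suc k) * U (suc k)))
      ≡⟨ factor σt (U (suc (suc k))) (a (suc k) * U (suc k)) ⟩
    σt * (U (suc (suc k)) - a (suc k) * U (suc k))
      ≡⟨ cong (σt *_) (U-rec k) ⟩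
    σt * (α * U′ (suc k) - β * U (suc k))
      ≡⟨ distribute σt α β (U′ (suc k)) (U (suc k)) ⟩
    α * (σt * U′ (suc k)) + - β * (σt * U (suc k)) ∎
    where
    σt = sgn (n ℕ.+ suc k) * stirling2 a n (suc k)
    factor : ∀ (s x y : ℤ) → s * x + - (s * y) ≡ s * (x - y)
    factor = solve-∀
    distribute : ∀ (s α β x y : ℤ) → s * (α * x - β * y) ≡ α * (s * x) + - β * (s * y)
    distribute = solve-∀

rising-suc-shift : ∀ w k → w * rising (w + + 1) k ≡ rising w (suc k)
rising-suc-shift w zero    = base w
  where
  base : ∀ (w : ℤ) → w * + 1 ≡ + 1 * (w + + 0)
  base = solve-∀
rising-suc-shift w (suc k) = begin
  w * (rising (w + + 1) k * (w + + 1 + + k))   ≡⟨ *-assoc w (rising (w + + 1) k) (w + + 1 + + k) ⟨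
  w * rising (w + + 1) k * (w + + 1 + + k)     ≡⟨ cong (_* (w + + 1 + + k)) (rising-suc-shift w k) ⟩
  rising w (suc k) * (w + + 1 + + k)           ≡⟨ cong (rising w (suc k) *_) (+-assoc w (+ 1) (+ k)) ⟩
  rising w (suc k) * (w + (+ 1 + + k))         ≡⟨ cong (λ x → rising w (suc k) * (w + x)) (pos-+ 1 k) ⟨
  rising w (suc (suc k))                       ∎
  where open ≡-Reasoning

-- j! (z)^j / z, the polynomials in which Defs expands F_n.
basis : ℤ → ℕ → ℤ
basis z zero    = + 0
basis z (suc k) = fact (suc k) * rising (z + + 1) k

Fv≡stirling2Sum : ∀ v n z → Fv v n z ≡ stirling2Sum (seqA v) n (basis z)
Fv≡stirling2Sum v n z = sumTo-cong n λ
  { zero    → sym (*-zeroʳ (sgn (n ℕ.+ 0) * Tv v n 0))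
  ; (suc k) → *-assoc (sgn (n ℕ.+ suc k) * Tv v n (suc k)) (fact (suc k)) (rising (z + + 1) k)
  }

basis-recurrence : ∀ v z k →
  basis z (suc (suc k)) - seqA v (suc k) * basis z (suc k)
    ≡ (z + + 1) * (z + + 1 - + v) * basis (z + + 1) (suc k) - z * (z - + v) * basis z (suc k)
basis-recurrence v z k = begin
  fact (suc (suc k)) * (r * (z + + 1 + K)) - seqA v (suc k) * (F * r)
    ≡⟨ cong₂ (λ x y → x * (r * (z + + 1 + K)) - y * (F * r)) fact-2+k seqA-1+k ⟩
  ((+ 1 + (+ 1 + K)) * F) * (r * (z + + 1 + K)) - ((+ 1 + K) * ((+ 1 + K) + + v)) * (F * r)
    ≡⟨ regroup z (+ v) K F r ⟩
  (z + + 1 - + v) * F * (r * (z + + 1 + K)) - z * (z - + v) * (F * r)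
    ≡⟨ cong (λ x → (z + + 1 - + v) * F * x - β) (rising-suc-shift (z + + 1) k) ⟨
  (z + + 1 - + v) * F * ((z + + 1) * X) - z * (z - + v) * (F * r)
    ≡⟨ reorder (z + + 1) (z + + 1 - + v) F X β ⟩
  (z + + 1) * (z + + 1 - + v) * (F * X) - z * (z - + v) * (F * r) ∎
  where
  open ≡-Reasoning
  K = + k
  F = fact (suc k)
  r = rising (z + + 1) k
  X = rising (z + + 1 + + 1) k
  β = z * (z - + v) * (F * r)
  fact-2+k : fact (suc (suc k)) ≡ (+ 1 + (+ 1 + K)) * F
  fact-2+k = trans (pos-* (suc (suc k)) (suc k !))
                   (cong (_* F) (trans (pos-+ 1 (suc k)) (cong (_+_ (+ 1)) (pos-+ 1 k))))
  seqA-1+k : seqA v (suc k) ≡ (+ 1 + K) * ((+ 1 + K) + + v)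
  seqA-1+k = trans (pos-* (suc k) (suc k ℕ.+ v))
                   (cong₂ _*_ (pos-+ 1 k) (trans (pos-+ (suc k) v) (cong (_+ + v) (pos-+ 1 k))))
  regroup : ∀ (z V K F r : ℤ) →
    ((+ 1 + (+ 1 + K)) * F) * (r * (z + + 1 + K)) - ((+ 1 + K) * ((+ 1 + K) + V)) * (F * r)
      ≡ (z + + 1 - V) * F * (r * (z + + 1 + K)) - z * (z - V) * (F * r)
  regroup = solve-∀
  reorder : ∀ (a b F X c : ℤ) → b * F * (a * X) - c ≡ a * b * (F * X) - c
  reorder = solve-∀

Fv-suc : ∀ v {n} z → 1 ℕ.≤ n →
  Fv v (suc n) z ≡ (z + + 1) * (z + + 1 - + v) * Fv v n (z + + 1) - z * (z - + v) * Fv v n z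
Fv-suc v {n} z 1≤n
  rewrite Fv≡stirling2Sum v (suc n) z | Fv≡stirling2Sum v n z | Fv≡stirling2Sum v n (z + + 1)
  = stirling2Sum-suc (seqA v) 1≤n ((z + + 1) * (z + + 1 - + v)) (z * (z - + v))
                     (basis z) (basis (z + + 1)) (basis-recurrence v z)

Fv-suc-at-m+v : ∀ v m {n} → 1 ℕ.≤ n →
  Fv v (suc n) (+ (m ℕ.+ v))
    ≡ + (suc m ℕ.+ v) * + suc m * Fv v n (+ (suc m ℕ.+ v))
      - + (m ℕ.+ v) * + m * Fv v n (+ (m ℕ.+ v))
Fv-suc-at-m+v v m {n} 1≤n = begin
  Fv v (suc n) w
    ≡⟨ Fv-suc v w 1≤n ⟩
  (w + + 1) * (w + + 1 - + v) * Fv v n (w + + 1) - w * (w - + v) * Fv v n w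
    ≡⟨ cong (λ x → x * (x - + v) * Fv v n x - w * (w - + v) * Fv v n w) w+1≡1+m+v ⟩
  + (suc m ℕ.+ v) * (+ (suc m ℕ.+ v) - + v) * Fv v n (+ (suc m ℕ.+ v)) - w * (w - + v) * Fv v n w
    ≡⟨ cong₂ (λ x y → + (suc m ℕ.+ v) * x * Fv v n (+ (suc m ℕ.+ v)) - w * y * Fv v n w)
             (m+v-v≡m (suc m)) (m+v-v≡m m) ⟩
  + (suc m ℕ.+ v) * + suc m * Fv v n (+ (suc m ℕ.+ v)) - w * + m * Fv v n w ∎
  where
  open ≡-Reasoning
  w = + (m ℕ.+ v)
  w+1≡1+m+v : w + + 1 ≡ + (suc m ℕ.+ v)
  w+1≡1+m+v = trans (sym (pos-+ (m ℕ.+ v) 1)) (cong +_ (ℕP.+-comm (m ℕ.+ v) 1))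
  m+v-v≡m : ∀ m → + (m ℕ.+ v) - + v ≡ + m
  m+v-v≡m m =
    trans (m-n≡m⊖n (m ℕ.+ v) v) (trans (⊖-≥ (m≤n+m v m)) (cong +_ (ℕP.m+n∸n≡m m v)))

factRatio-zero : ∀ v → factRatio 0 v ≡ 1
factRatio-zero v = n/n≡1 (v !) ⦃ v !≢0 ⦄

factRatio-suc : ∀ m v → factRatio (suc m) v ≡ suc (m ℕ.+ v) ℕ.* factRatio m v
factRatio-suc m v = *-/-assoc (suc (m ℕ.+ v)) ⦃ v !≢0 ⦄ (m≤n⇒m!∣n! (m≤n+m v m))

closedForm : ℕ → ℕ → ℕ → ℤ
closedForm v m n = Fv v n (+ (m ℕ.+ v)) * fact m * + factRatio m v

closedForm-zero : ∀ v n → closedForm v 0 n ≡ gv v (n ℕ.+ 0)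
closedForm-zero v n = begin
  Fv v n (+ v) * + 1 * + factRatio 0 v  ≡⟨ cong (λ r → Fv v n (+ v) * + 1 * + r) (factRatio-zero v) ⟩
  Fv v n (+ v) * + 1 * + 1              ≡⟨ *-identityʳ (Fv v n (+ v) * + 1) ⟩
  Fv v n (+ v) * + 1                    ≡⟨ *-identityʳ (Fv v n (+ v)) ⟩
  Fv v n (+ v)                          ≡⟨ cong (λ k → gv v k) (ℕP.+-identityʳ n) ⟨
  gv v (n ℕ.+ 0)                        ∎
  where open ≡-Reasoning

closedForm-suc : ∀ v m {n} → 1 ℕ.≤ n →
  closedForm v m (suc n) + seqA v m * closedForm v m n ≡ closedForm v (suc m) n
closedForm-suc v m {n} 1≤n = begin
  Fv v (suc n) w * f * r + seqA v m * (Fv v n w * f * r)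
    ≡⟨ cong₂ (λ x y → x * f * r + y * (Fv v n w * f * r))
             (Fv-suc-at-m+v v m 1≤n) (pos-* m (m ℕ.+ v)) ⟩
  (w₁ * + suc m * Fv v n w₁ - w * + m * Fv v n w) * f * r + (+ m * w) * (Fv v n w * f * r)
    ≡⟨ collect w₁ (+ suc m) (Fv v n w₁) w (+ m) (Fv v n w) f r ⟩
  Fv v n w₁ * (+ suc m * f) * (w₁ * r)
    ≡⟨ cong₂ (λ x y → Fv v n w₁ * x * y) (pos-* (suc m) (m !)) w₁*r≡ ⟨
  Fv v n w₁ * fact (suc m) * + factRatio (suc m) v ∎
  where
  open ≡-Reasoning
  w  = + (m ℕ.+ v)
  w₁ = + (suc m ℕ.+ v)
  f  = fact m
  r  = + factRatio m v
  w₁*r≡ : + factRatio (suc m) v ≡ w₁ * r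
  w₁*r≡ = trans (cong +_ (factRatio-suc m v)) (pos-* (suc (m ℕ.+ v)) (factRatio m v))
  -- w - v = m cancels against a_m = m w
  collect : ∀ (w₁ m₁ A w m B f r : ℤ) →
    (w₁ * m₁ * A - w * m * B) * f * r + (m * w) * (B * f * r) ≡ A * (m₁ * f) * (w₁ * r)
  collect = solve-∀

proposition8 : (v m n : ℕ) → 1 ℕ.≤ n →
    sumTo m (λ j → sgn (m ℕ.+ j) * tv v m j * gv v (n ℕ.+ j))
    ≡ Fv v n (+ (m ℕ.+ v)) * fact m * + factRatio m v
proposition8 v zero    n _   = trans (*-identityˡ (gv v (n ℕ.+ 0))) (sym (closedForm-zero v n))
proposition8 v (suc m) n 1≤n = begin
  stirling1Sum (seqA v) (suc m) (g n)
    ≡⟨ stirling1Sum-suc (seqA v) refl m (g n) ⟩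
  stirling1Sum (seqA v) m (λ j → g n (suc j)) + seqA v m * stirling1Sum (seqA v) m (g n)
    ≡⟨ cong₂ (λ x y → x + seqA v m * y)
             (trans (sumTo-cong m shift) (proposition8 v m (suc n) (s≤s z≤n)))
             (proposition8 v m n 1≤n) ⟩
  closedForm v m (suc n) + seqA v m * closedForm v m n
    ≡⟨ closedForm-suc v m 1≤n ⟩
  closedForm v (suc m) n ∎
  where
  open ≡-Reasoning
  g : ℕ → ℕ → ℤ
  g n j = gv v (n ℕ.+ j)
  shift : ∀ j → sgn (m ℕ.+ j) * tv v m j * g n (suc j) ≡ sgn (m ℕ.+ j) * tv v m j * g (suc n) j
  shift j = cong (λ i → sgn (m ℕ.+ j) * tv v m j * gv v i) (+-suc n j)
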